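{- Let $G$ be a connected graph. If $\beta(G,S)\in\mathcal{G}^{\mathrm{cs}}$ for every subset $S\subset V(G)$, then $G\in\mathcal{G}^{\mathrm{cs}}$.
   Context: All graphs are finite and simple. A weight function on $V(G)$ is a map $w:V(G)\to\mathbb{R}_{>0}$; for $X\subseteq V(G)$ put $w(X)=\sum_{v\in X}w(v)$. A non-empty set $S\subseteq V(G)$ is a weighted safe set of $(G,w)$ if for every component $C$ of the induced subgraph $G[S]$ and every component $D$ of $G-S$ such that some edge joins $C$ and $D$, we have $w(C)\ge w(D)$. It is a connected weighted safe set if moreover $G[S]$ is connected. $\mathrm{s}(G,w)$ (resp. $\mathrm{cs}(G,w)$) is the minimum of $w(S)$ over all weighted safe sets (resp. connected weighted safe sets) $S$ of $(G,w)$. $\mathcal{G}^{\mathrm{cs}}$ denotes the family of all graphs $G$ such that $\mathrm{s}(G,w)=\mathrm{cs}(G,w)$ for every weight function $w$ on $V(G)$. For a connected graph $G$ and $S\subseteq V(G)$, $\beta(G,S)$ is the graph whose vertices are the components of $G[S]$ and the components of $G-S$, two such components $A,B$ being adjacent iff some edge of $G$ joins a vertex of $A$ to a vertex of $B$.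
   Formalization: The weight functions defining $\mathcal{G}^{\mathrm{cs}}$ take positive rational values instead of positive real ones. -}

module Defs where

open import Data.Nat using (ℕ)
open import Data.Fin using (Fin; zero; suc)
open import Data.Bool using (Bool; true; false; T; not)
open import Data.Rational using (ℚ; 0ℚ; _+_; _≤_; _<_)
open import Data.Product using (Σ; ∃; _×_; _,_)
open import Data.Sum using (_⊎_)
open import Relation.Binary.PropositionalEquality using (_≡_; _≢_)
open import Function.Bundles using (_⇔_)

record Graph : Set where
  field
    n      : ℕ
    adj    : Fin n → Fin n → Bool
    sym    : ∀ u v → adj u v ≡ adj v u
    irrefl : ∀ v → adj v v ≡ false
open Graph public

VSet : Graph → Set
VSet G = Fin (n G) → Bool

_∈_ : {G : Graph} → Fin (n G) → VSet G → Set
v ∈ X = T (X v)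

_⊆_ : {G : Graph} → VSet G → VSet G → Set
_⊆_ {G} X Y = ∀ (v : Fin (n G)) → T (X v) → T (Y v)

complement : {G : Graph} → VSet G → VSet G
complement X v = not (X v)

data PathIn (G : Graph) (X : VSet G) : Fin (n G) → Fin (n G) → Set where
  here : ∀ {u} → T (X u) → PathIn G X u u
  step : ∀ {u w v} → T (X u) → T (adj G u w) → PathIn G X w v → PathIn G X u v

ConnectedIn : (G : Graph) → VSet G → Set
ConnectedIn G X = (∃ λ v → T (X v)) × (∀ u v → T (X u) → T (X v) → PathIn G X u v)

ConnectedGraph : Graph → Set
ConnectedGraph G = ConnectedIn G (λ _ → true)

-- C is (the vertex set of) a component of G[X]: a non-empty connected
-- subset of X closed under adjacency inside X (i.e. maximal).
IsComponent : (G : Graph) → VSet G → VSet G → Set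
IsComponent G X C =
  _⊆_ {G} C X × ConnectedIn G C ×
  (∀ u v → T (C u) → T (X v) → T (adj G u v) → T (C v))

Joined : (G : Graph) → VSet G → VSet G → Set
Joined G A B = ∃ λ u → ∃ λ v → T (A u) × T (B v) × T (adj G u v)

∑ : ∀ {m} → (Fin m → ℚ) → ℚ
∑ {ℕ.zero} f = 0ℚ
∑ {ℕ.suc m} f = f zero + ∑ (λ i → f (suc i))

Weight : Graph → Set
Weight G = Fin (n G) → ℚ

PositiveWeight : (G : Graph) → Weight G → Set
PositiveWeight G w = ∀ v → 0ℚ < w v

wt : {G : Graph} → Weight G → VSet G → ℚ
wt w X = ∑ (λ v → if X v then w v else 0ℚ)
  where open import Data.Bool using (if_then_else_)

IsSafe : (G : Graph) → Weight G → VSet G → Set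
IsSafe G w S =
  (∃ λ v → T (S v)) ×
  (∀ C D → IsComponent G S C → IsComponent G (complement {G} S) D →
     Joined G C D → wt {G} w D ≤ wt {G} w C)

IsConnSafe : (G : Graph) → Weight G → VSet G → Set
IsConnSafe G w S = IsSafe G w S × ConnectedIn G S

IsMinWeight : (G : Graph) → Weight G → (VSet G → Set) → ℚ → Set
IsMinWeight G w P x =
  (∃ λ S → P S × wt {G} w S ≡ x) × (∀ S → P S → x ≤ wt {G} w S)

IsS : (G : Graph) → Weight G → ℚ → Set
IsS G w = IsMinWeight G w (IsSafe G w)

IsCS : (G : Graph) → Weight G → ℚ → Set
IsCS G w = IsMinWeight G w (IsConnSafe G w)

InGcs : Graph → Set
InGcs G = ∀ (w : Weight G) → PositiveWeight G w →
          ∀ a b → IsS G w a → IsCS G w b → a ≡ b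

SameComponent : (G : Graph) → VSet G → Fin (n G) → Fin (n G) → Set
SameComponent G S u v =
  (∃ λ C → IsComponent G S C × T (C u) × T (C v)) ⊎
  (∃ λ D → IsComponent G (complement {G} S) D × T (D u) × T (D v))

-- H together with π : V(G) → V(H) is (a copy of) β(G,S): the vertices of H
-- are exactly the classes of π, which are the components of G[S] and of G - S,
-- and distinct vertices of H are adjacent iff some edge of G joins the
-- corresponding components.
IsBeta : (G : Graph) → VSet G → (H : Graph) → (Fin (n G) → Fin (n H)) → Set
IsBeta G S H π =
  (∀ x → ∃ λ u → π u ≡ x) ×
  (∀ u v → (π u ≡ π v) ⇔ SameComponent G S u v) ×
  (∀ x y → T (adj H x y) ⇔
     (x ≢ y × (∃ λ u → ∃ λ v → π u ≡ x × π v ≡ y × T (adj G u v))))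

module Submission where

-- Let S be a minimum-weight safe set of (G, w) and let π collapse every component of G[S] and of
-- G - S to a vertex of β(G,S), weighted by the total weight of its fibre. Adjacent vertices of
-- β(G,S) come from different sides of S, so each component of β(G,S) minus the image of S is a
-- single vertex; hence the image of S is safe and s(β) = cs(β) ≤ w(S). Conversely the preimage
-- of a connected safe set of β(G,S) is a connected safe set of G of the same weight: each
-- component of its complement is a union of fibres and maps onto a component of the complement
-- in β(G,S). So cs(G,w) ≤ s(G,w), and s ≤ cs always. Constructing β(G,S) needs decidable
-- reachability, and the minima over subsets of V(β) need decidable safety; both come from
-- excluded middle, which is harmless because the final inequality between rationals is
-- decidable: the argument runs in the double-negation monad.

open import Defs hiding (sym; _∈_)
open import Algebra.Properties.CommutativeMonoid.Sum as CommutativeMonoidSum using ()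
open import Data.Bool using (Bool; true; false; T; not; if_then_else_)
open import Data.Bool.Properties using (not-injective; if-eta)
open import Data.Empty using (⊥; ⊥-elim)
open import Data.Fin using (Fin; zero; suc; _≟_; punchIn)
open import Data.Fin.Properties using (any?; ∀-cons; suc-injective; punchInᵢ≢i)
open import Data.Nat using (ℕ)
open import Data.Product using (∃; _×_; _,_; proj₁; proj₂)
open import Data.Rational using (ℚ; 0ℚ; _+_; _≤_)
open import Data.Rational.Properties as ℚ using ()
open import Data.Sum using (_⊎_; inj₁; inj₂)
open import Data.Unit using (tt)
open import Data.List using (List; []; _∷_; [_]; map; _++_)
open import Data.List.Membership.Propositional using (_∈_)
open import Data.List.Membership.Propositional.Properties using (∈-map⁺; ∈-++⁺ˡ; ∈-++⁺ʳ)
open import Data.List.Relation.Unary.All as All using (All; []; _∷_)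
open import Data.List.Relation.Unary.Any as Any using ()
open import Data.Vec.Functional as Vector using (Vector; replicate)
open import Effect.Monad using (RawMonad)
open import Function using (_∘_)
open import Function.Bundles using (mk⇔; Equivalence)
open import Level using (0ℓ)
open import Relation.Binary.PropositionalEquality
  using (_≡_; _≢_; _≗_; refl; sym; trans; cong; subst; subst₂; module ≡-Reasoning)
open import Relation.Binary.Structures using (IsDecEquivalence)
open import Relation.Nullary using (¬_; Dec; yes; no)
open import Relation.Nullary.Decidable
  using (¬?; _×-dec_; T?; ⌊_⌋; toWitness; fromWitness; isYes≗does; dec-false; decidable-stable; ¬¬-excluded-middle)
open import Relation.Nullary.Negation using (¬¬-Monad)

open RawMonad (¬¬-Monad {0ℓ}) using (_>>=_; pure)

¬¬-Π-Fin : ∀ {k} {P : Fin k → Set} → (∀ i → ¬ ¬ P i) → ¬ ¬ (∀ i → P i)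
¬¬-Π-Fin {ℕ.zero} _ = pure λ ()
¬¬-Π-Fin {ℕ.suc k} {P} ¬¬P = do
  p₀ ← ¬¬P zero
  p₊ ← ¬¬-Π-Fin {P = P ∘ suc} (¬¬P ∘ suc)
  pure (∀-cons p₀ p₊)

¬¬-decidable₂ : ∀ {k l} (R : Fin k → Fin l → Set) → ¬ ¬ (∀ u v → Dec (R u v))
¬¬-decidable₂ R = ¬¬-Π-Fin λ u → ¬¬-Π-Fin λ v → ¬¬-excluded-middle

T-ext : {a b : Bool} → (T a → T b) → (T b → T a) → a ≡ b
T-ext {false} {false} _ _ = refl
T-ext {false} {true}  _ g = ⊥-elim (g tt)
T-ext {true}  {false} f _ = ⊥-elim (f tt)
T-ext {true}  {true}  _ _ = refl

T-contradiction : {b : Bool} → T b → T (not b) → ⊥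
T-contradiction {true} _ ()

T-both : ∀ {a b} → T a → T b → a ≡ b
T-both a∈ b∈ = T-ext (λ _ → b∈) (λ _ → a∈)

T-not-both : ∀ {a b} → T (not a) → T (not b) → a ≡ b
T-not-both a∉ b∉ = not-injective (T-both a∉ b∉)

T-or-T-not : ∀ b → T b ⊎ T (not b)
T-or-T-not true  = inj₁ tt
T-or-T-not false = inj₂ tt

open CommutativeMonoidSum ℚ.+-0-commutativeMonoid
  using (sum; sum-cong-≗; sum-remove; sum-replicate-zero; ∑-comm)

∑≡sum : ∀ {m} (f : Fin m → ℚ) → ∑ f ≡ sum f
∑≡sum {ℕ.zero} f = refl
∑≡sum {ℕ.suc m} f = cong (f zero +_) (∑≡sum (f ∘ suc))

∑-cong : ∀ {m} {f g : Fin m → ℚ} → f ≗ g → ∑ f ≡ ∑ g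
∑-cong {f = f} {g} f≗g = trans (∑≡sum f) (trans (sum-cong-≗ f≗g) (sym (∑≡sum g)))

∑-mono : ∀ {m} {f g : Fin m → ℚ} → (∀ i → f i ≤ g i) → ∑ f ≤ ∑ g
∑-mono {ℕ.zero} _ = ℚ.≤-refl
∑-mono {ℕ.suc m} f≤g = ℚ.+-mono-≤ (f≤g zero) (∑-mono (f≤g ∘ suc))

∑∑≡sum-sum : ∀ {m k} (f : Fin m → Fin k → ℚ) → ∑ (λ i → ∑ (f i)) ≡ sum (λ i → sum (f i))
∑∑≡sum-sum f = trans (∑-cong (∑≡sum ∘ f)) (∑≡sum (λ i → sum (f i)))

∑-swap : ∀ {m k} (f : Fin m → Fin k → ℚ) → ∑ (λ i → ∑ (f i)) ≡ ∑ (λ j → ∑ (λ i → f i j))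
∑-swap f = trans (∑∑≡sum-sum f) (trans (∑-comm f) (sym (∑∑≡sum-sum (λ j i → f i j))))

∑-zero : ∀ m → ∑ {m} (λ _ → 0ℚ) ≡ 0ℚ
∑-zero m = trans (∑≡sum (replicate m 0ℚ)) (sum-replicate-zero m)

∑-supported : ∀ {m} (f : Fin m → ℚ) (p : Fin m) → (∀ i → i ≢ p → f i ≡ 0ℚ) → ∑ f ≡ f p
∑-supported {ℕ.suc m} f p vanishes = begin
  ∑ f                                   ≡⟨ ∑≡sum f ⟩
  sum f                                 ≡⟨ sum-remove {i = p} f ⟩
  f p + sum (f ∘ punchIn p)             ≡⟨ cong (f p +_) (sum-cong-≗ {x = f ∘ punchIn p} {y = replicate m 0ℚ} off-p) ⟩
  f p + sum (replicate m 0ℚ)            ≡⟨ cong (f p +_) (sum-replicate-zero m) ⟩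
  f p + 0ℚ                              ≡⟨ ℚ.+-identityʳ (f p) ⟩
  f p                                   ∎
  where
  open ≡-Reasoning
  off-p : ∀ i → f (punchIn p i) ≡ 0ℚ
  off-p i = vanishes (punchIn p i) (punchInᵢ≢i p i)

if-T : ∀ {b} {x : ℚ} → T b → (if b then x else 0ℚ) ≡ x
if-T {true} _ = refl

if-¬T : ∀ {b} {x : ℚ} → ¬ T b → (if b then x else 0ℚ) ≡ 0ℚ
if-¬T {false} _ = refl
if-¬T {true}  ¬b = ⊥-elim (¬b tt)

if-mono : ∀ {a b} {x : ℚ} → 0ℚ ≤ x → (T a → T b) → (if a then x else 0ℚ) ≤ (if b then x else 0ℚ)
if-mono {false} {false} _   _ = ℚ.≤-refl
if-mono {false} {true}  0≤x _ = 0≤x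
if-mono {true}  {false} _   a⇒b = ⊥-elim (a⇒b tt)
if-mono {true}  {true}  _   _ = ℚ.≤-refl

if-∑ : ∀ b {m} (f : Fin m → ℚ) → (if b then ∑ f else 0ℚ) ≡ ∑ (λ i → if b then f i else 0ℚ)
if-∑ true  f = refl
if-∑ false {m} f = sym (∑-zero m)

module _ {G : Graph} (w : Weight G) where

  singleton : Fin (n G) → VSet G
  singleton y u = ⌊ u ≟ y ⌋

  wt-cong : {X Y : VSet G} → X ≗ Y → wt {G} w X ≡ wt {G} w Y
  wt-cong X≗Y = ∑-cong (λ v → cong (λ b → if b then w v else 0ℚ) (X≗Y v))

  wt-singleton : ∀ y → wt {G} w (singleton y) ≡ w y
  wt-singleton y =
    trans (∑-supported _ y (λ u u≢y → if-¬T {⌊ u ≟ y ⌋} (u≢y ∘ toWitness)))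
          (if-T {⌊ y ≟ y ⌋} (fromWitness refl))

  module _ (w≥0 : ∀ v → 0ℚ ≤ w v) where

    wt-mono : {X Y : VSet G} → (∀ v → T (X v) → T (Y v)) → wt {G} w X ≤ wt {G} w Y
    wt-mono X⊆Y = ∑-mono (λ v → if-mono (w≥0 v) (X⊆Y v))

    w≤wt : {X : VSet G} {v : Fin (n G)} → T (X v) → w v ≤ wt {G} w X
    w≤wt {X} {v} v∈X = subst (_≤ wt {G} w X) (wt-singleton v)
      (wt-mono (λ u u∈ → subst (T ∘ X) (sym (toWitness u∈)) v∈X))

    wt≤w : {X : VSet G} {y : Fin (n G)} → (∀ u → T (X u) → u ≡ y) → wt {G} w X ≤ w y
    wt≤w {X} {y} X⊆y = subst (wt {G} w X ≤_) (wt-singleton y) (wt-mono (λ u u∈ → fromWitness (X⊆y u u∈)))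

subsets : ∀ k → List (Vector Bool k)
subsets ℕ.zero    = [ Vector.[] ]
subsets (ℕ.suc k) = map (true Vector.∷_) (subsets k) ++ map (false Vector.∷_) (subsets k)

subsets-complete : ∀ {k} (X : Vector Bool k) → ∃ λ Y → Y ∈ subsets k × X ≗ Y
subsets-complete {ℕ.zero} X = Vector.[] , Any.here refl , λ ()
subsets-complete {ℕ.suc k} X with subsets-complete (X ∘ suc)
... | Y , Y∈ , X∘suc≗Y =
  X zero Vector.∷ Y , cons-∈ (X zero) Y∈ , λ { zero → refl ; (suc i) → X∘suc≗Y i }
  where
  cons-∈ : ∀ b {Z} → Z ∈ subsets k → (b Vector.∷ Z) ∈ subsets (ℕ.suc k)
  cons-∈ true  = ∈-++⁺ˡ ∘ ∈-map⁺ (true Vector.∷_)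
  cons-∈ false = ∈-++⁺ʳ _ ∘ ∈-map⁺ (false Vector.∷_)

module _ (Q : ℚ → Set) where

  LeastIn : List ℚ → ℚ → Set
  LeastIn L q = Q q × All (λ r → Q r → q ≤ r) L

  least-or-none : ∀ L → ¬ ¬ (∃ (LeastIn L) ⊎ All (¬_ ∘ Q) L)
  least-or-none [] = pure (inj₂ [])
  least-or-none (x ∷ L) = do
    Q-x? ← ¬¬-excluded-middle
    rest ← least-or-none L
    pure (extend Q-x? rest)
    where
    extend : Dec (Q x) → ∃ (LeastIn L) ⊎ All (¬_ ∘ Q) L → ∃ (LeastIn (x ∷ L)) ⊎ All (¬_ ∘ Q) (x ∷ L)
    extend (no ¬Qx) (inj₂ none) = inj₂ (¬Qx ∷ none)
    extend (no ¬Qx) (inj₁ (q , Qq , least)) = inj₁ (q , Qq , (λ Qx → ⊥-elim (¬Qx Qx)) ∷ least)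
    extend (yes Qx) (inj₂ none) =
      inj₁ (x , Qx , (λ _ → ℚ.≤-refl) ∷ All.map (λ ¬Qr Qr → ⊥-elim (¬Qr Qr)) none)
    extend (yes Qx) (inj₁ (q , Qq , least)) with ℚ.≤-total x q
    ... | inj₁ x≤q =
      inj₁ (x , Qx , (λ _ → ℚ.≤-refl) ∷ All.map (λ q≤r Qr → ℚ.≤-trans x≤q (q≤r Qr)) least)
    ... | inj₂ q≤x = inj₁ (q , Qq , (λ _ → q≤x) ∷ least)

-- Subsets are enumerated only up to ≗, so the minimum is taken over the list of their weights.
minimum-exists : (G : Graph) (w : Weight G) (P : VSet G → Set) → ∃ P → ¬ ¬ ∃ (IsMinWeight G w P)
minimum-exists G w P (S₀ , P-S₀) = do
  result ← least-or-none Attained weights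
  pure (minimum result)
  where
  Attained : ℚ → Set
  Attained q = ∃ λ S → P S × wt {G} w S ≡ q
  weights : List ℚ
  weights = map (wt {G} w) (subsets (n G))
  listed : ∀ S → wt {G} w S ∈ weights
  listed S =
    let (Y , Y∈ , S≗Y) = subsets-complete S
    in subst (_∈ weights) (sym (wt-cong {G} w S≗Y)) (∈-map⁺ (wt {G} w) Y∈)
  minimum : ∃ (LeastIn Attained weights) ⊎ All (¬_ ∘ Attained) weights → ∃ (IsMinWeight G w P)
  minimum (inj₁ (q , attained , least)) = q , attained , λ S P-S → All.lookup least (listed S) (S , P-S , refl)
  minimum (inj₂ none) = ⊥-elim (All.lookup none (listed S₀) (S₀ , P-S₀ , refl))

module _ {G : Graph} where

  adj-sym : ∀ {u v} → T (adj G u v) → T (adj G v u)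
  adj-sym {u} {v} = subst T (Graph.sym G u v)

  path-mono : {X Y : VSet G} → (∀ v → T (X v) → T (Y v)) → ∀ {u v} → PathIn G X u v → PathIn G Y u v
  path-mono X⊆Y (here u∈) = here (X⊆Y _ u∈)
  path-mono X⊆Y (step u∈ uw p) = step (X⊆Y _ u∈) uw (path-mono X⊆Y p)

  path-source : {X : VSet G} → ∀ {u v} → PathIn G X u v → T (X u)
  path-source (here u∈) = u∈
  path-source (step u∈ _ _) = u∈

  path-target : {X : VSet G} → ∀ {u v} → PathIn G X u v → T (X v)
  path-target (here v∈) = v∈
  path-target (step _ _ p) = path-target p

  path-++ : {X : VSet G} → ∀ {u v w} → PathIn G X u v → PathIn G X v w → PathIn G X u w
  path-++ (here _) q = q
  path-++ (step u∈ uw p) q = step u∈ uw (path-++ p q)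

  path-∷ʳ : {X : VSet G} → ∀ {u v w} → PathIn G X u v → T (X w) → T (adj G v w) → PathIn G X u w
  path-∷ʳ p w∈ vw = path-++ p (step (path-target p) vw (here w∈))

  path-reverse : {X : VSet G} → ∀ {u v} → PathIn G X u v → PathIn G X v u
  path-reverse (here u∈) = here u∈
  path-reverse (step u∈ uw p) = path-∷ʳ (path-reverse p) u∈ (adj-sym uw)

  path-in-independent : {X : VSet G} → (∀ {x y} → T (X x) → T (X y) → ¬ T (adj G x y)) →
                        ∀ {u v} → PathIn G X u v → u ≡ v
  path-in-independent _ (here _) = refl
  path-in-independent independent (step u∈ uw p) = ⊥-elim (independent u∈ (path-source p) uw)

  module _ {X C : VSet G} (C-comp : IsComponent G X C) where

    component-⊆ : ∀ {v} → T (C v) → T (X v)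
    component-⊆ = proj₁ C-comp _

    component-connected : ConnectedIn G C
    component-connected = proj₁ (proj₂ C-comp)

    component-closed : ∀ {u v} → T (C u) → T (X v) → T (adj G u v) → T (C v)
    component-closed = proj₂ (proj₂ C-comp) _ _

    component-path-closed : ∀ {u v} → T (C u) → PathIn G X u v → T (C v)
    component-path-closed u∈ (here _) = u∈
    component-path-closed u∈ (step _ uw p) = component-path-closed (component-closed u∈ (path-source p) uw) p

    connected-meeting-component-⊆ : {Y : VSet G} → ConnectedIn G Y → (∀ v → T (Y v) → T (X v)) →
                                    ∀ {u} → T (Y u) → T (C u) → ∀ {v} → T (Y v) → T (C v)
    connected-meeting-component-⊆ (_ , Y-paths) Y⊆X u∈Y u∈C v∈Y =
      component-path-closed u∈C (path-mono Y⊆X (Y-paths _ _ u∈Y v∈Y))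

  components-meeting-⊆ : {X C C′ : VSet G} → IsComponent G X C → IsComponent G X C′ →
                         ∀ {v} → T (C v) → T (C′ v) → ∀ {w} → T (C′ w) → T (C w)
  components-meeting-⊆ C-comp C′-comp v∈C v∈C′ =
    connected-meeting-component-⊆ C-comp (component-connected C′-comp) (λ _ → component-⊆ C′-comp) v∈C′ v∈C

  whole-safe : (w : Weight G) → Fin (n G) → IsSafe G w (λ _ → true)
  whole-safe w v = (v , tt) , λ _ _ _ D-comp _ →
    ⊥-elim (component-⊆ D-comp (proj₂ (proj₁ (component-connected D-comp))))

  connected-isComponent : {X : VSet G} → ConnectedIn G X → IsComponent G X X
  connected-isComponent X-conn = (λ _ v∈ → v∈) , X-conn , (λ _ _ _ v∈ _ → v∈)

  module _ {X : VSet G} (reach? : ∀ u v → Dec (PathIn G X u v)) where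

    reachable : Fin (n G) → VSet G
    reachable u v = ⌊ reach? u v ⌋

    reachable-isComponent : ∀ {u} → T (X u) → IsComponent G X (reachable u)
    reachable-isComponent {u} u∈ =
      (λ v r → path-target (toWitness r)) ,
      ((u , fromWitness (here u∈)) ,
       λ a b ra rb → paths-in-reachable (toWitness ra) (path-++ (path-reverse (toWitness ra)) (toWitness rb))) ,
      (λ a b ra b∈ ab → fromWitness (path-∷ʳ (toWitness ra) b∈ ab))
      where
      paths-in-reachable : ∀ {a b} → PathIn G X u a → PathIn G X a b → PathIn G (reachable u) a b
      paths-in-reachable ua (here a∈) = here (fromWitness ua)
      paths-in-reachable ua (step a∈ ac p) =
        step (fromWitness ua) ac (paths-in-reachable (path-∷ʳ ua (path-source p) ac) p)

module _ {G : Graph} {S : VSet G} where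

  same-component-path : ∀ {u v} → SameComponent G S u v →
                        ∃ λ K → PathIn G K u v × (∀ {c} → T (K c) → SameComponent G S u c)
  same-component-path (inj₁ (C , C-comp , u∈ , v∈)) =
    C , proj₂ (component-connected C-comp) _ _ u∈ v∈ , λ c∈ → inj₁ (C , C-comp , u∈ , c∈)
  same-component-path (inj₂ (D , D-comp , u∈ , v∈)) =
    D , proj₂ (component-connected D-comp) _ _ u∈ v∈ , λ c∈ → inj₂ (D , D-comp , u∈ , c∈)

  same-side : ∀ {u v} → SameComponent G S u v → S u ≡ S v
  same-side (inj₁ (C , C-comp , u∈ , v∈)) = T-both (component-⊆ C-comp u∈) (component-⊆ C-comp v∈)
  same-side (inj₂ (D , D-comp , u∈ , v∈)) = T-not-both (component-⊆ D-comp u∈) (component-⊆ D-comp v∈)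

  same-component-adjacent : ∀ {u v} → SameComponent G S u u → T (adj G u v) → S u ≡ S v → SameComponent G S u v
  same-component-adjacent (inj₁ (C , C-comp , u∈ , _)) uv Su≡Sv =
    inj₁ (C , C-comp , u∈ , component-closed C-comp u∈ (subst T Su≡Sv (component-⊆ C-comp u∈)) uv)
  same-component-adjacent (inj₂ (D , D-comp , u∈ , _)) uv Su≡Sv =
    inj₂ (D , D-comp , u∈ , component-closed D-comp u∈ (subst (T ∘ not) Su≡Sv (component-⊆ D-comp u∈)) uv)

  same-sym : ∀ {u v} → SameComponent G S u v → SameComponent G S v u
  same-sym (inj₁ (C , C-comp , u∈ , v∈)) = inj₁ (C , C-comp , v∈ , u∈)
  same-sym (inj₂ (D , D-comp , u∈ , v∈)) = inj₂ (D , D-comp , v∈ , u∈)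

  same-trans : ∀ {u v w} → SameComponent G S u v → SameComponent G S v w → SameComponent G S u w
  same-trans (inj₁ (C , C-comp , u∈C , v∈C)) (inj₁ (C′ , C′-comp , v∈C′ , w∈C′)) =
    inj₁ (C , C-comp , u∈C , components-meeting-⊆ C-comp C′-comp v∈C v∈C′ w∈C′)
  same-trans (inj₂ (D , D-comp , u∈D , v∈D)) (inj₂ (D′ , D′-comp , v∈D′ , w∈D′)) =
    inj₂ (D , D-comp , u∈D , components-meeting-⊆ D-comp D′-comp v∈D v∈D′ w∈D′)
  same-trans (inj₁ (C , C-comp , _ , v∈C)) (inj₂ (D , D-comp , v∈D , _)) =
    ⊥-elim (T-contradiction (component-⊆ C-comp v∈C) (component-⊆ D-comp v∈D))
  same-trans (inj₂ (D , D-comp , _ , v∈D)) (inj₁ (C , C-comp , v∈C , _)) =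
    ⊥-elim (T-contradiction (component-⊆ C-comp v∈C) (component-⊆ D-comp v∈D))

record Quotient {k : ℕ} (_≈_ : Fin k → Fin k → Set) : Set where
  field
    m            : ℕ
    π            : Fin k → Fin m
    π-surjective : ∀ x → ∃ λ u → π u ≡ x
    π-≡⇒≈        : ∀ {u v} → π u ≡ π v → u ≈ v
    ≈⇒π-≡        : ∀ {u v} → u ≈ v → π u ≡ π v

module _ {k} {_≈_ : Fin (ℕ.suc k) → Fin (ℕ.suc k) → Set} (≈-isDecEquivalence : IsDecEquivalence _≈_) where
  open IsDecEquivalence ≈-isDecEquivalence
    renaming (refl to ≈-refl; sym to ≈-sym; trans to ≈-trans; _≟_ to _≈?_)

  tail-isDecEquivalence : IsDecEquivalence (λ i j → suc i ≈ suc j)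
  tail-isDecEquivalence = record
    { isEquivalence = record { refl = ≈-refl ; sym = ≈-sym ; trans = ≈-trans }
    ; _≟_ = λ i j → suc i ≈? suc j
    }

  module _ (Q : Quotient (λ i j → suc i ≈ suc j)) where
    open Quotient Q

    quotient-joining : ∀ i → zero ≈ suc i → Quotient _≈_
    quotient-joining i 0≈i = record
      { m = m ; π = π′ ; π-surjective = π′-surjective
      ; π-≡⇒≈ = π′-≡⇒≈ ; ≈⇒π-≡ = ≈⇒π′-≡ }
      where
      π′ : Fin (ℕ.suc k) → Fin m
      π′ zero = π i
      π′ (suc u) = π u

      π′-surjective : ∀ x → ∃ λ u → π′ u ≡ x
      π′-surjective x = let (u , πu≡x) = π-surjective x in suc u , πu≡x

      π′-≡⇒≈ : ∀ {u v} → π′ u ≡ π′ v → u ≈ v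
      π′-≡⇒≈ {zero}  {zero}  _ = ≈-refl
      π′-≡⇒≈ {zero}  {suc v} e = ≈-trans 0≈i (π-≡⇒≈ e)
      π′-≡⇒≈ {suc u} {zero}  e = ≈-sym (≈-trans 0≈i (π-≡⇒≈ (sym e)))
      π′-≡⇒≈ {suc u} {suc v} e = π-≡⇒≈ e

      ≈⇒π′-≡ : ∀ {u v} → u ≈ v → π′ u ≡ π′ v
      ≈⇒π′-≡ {zero}  {zero}  _ = refl
      ≈⇒π′-≡ {zero}  {suc v} e = ≈⇒π-≡ (≈-trans (≈-sym 0≈i) e)
      ≈⇒π′-≡ {suc u} {zero}  e = ≈⇒π-≡ (≈-trans e 0≈i)
      ≈⇒π′-≡ {suc u} {suc v} e = ≈⇒π-≡ e

    quotient-new-class : (∀ i → ¬ zero ≈ suc i) → Quotient _≈_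
    quotient-new-class 0≉ = record
      { m = ℕ.suc m ; π = π′ ; π-surjective = π′-surjective
      ; π-≡⇒≈ = π′-≡⇒≈ ; ≈⇒π-≡ = ≈⇒π′-≡ }
      where
      π′ : Fin (ℕ.suc k) → Fin (ℕ.suc m)
      π′ zero = zero
      π′ (suc u) = suc (π u)

      π′-surjective : ∀ x → ∃ λ u → π′ u ≡ x
      π′-surjective zero = zero , refl
      π′-surjective (suc x) = let (u , πu≡x) = π-surjective x in suc u , cong suc πu≡x

      π′-≡⇒≈ : ∀ {u v} → π′ u ≡ π′ v → u ≈ v
      π′-≡⇒≈ {zero}  {zero}  _ = ≈-refl
      π′-≡⇒≈ {suc u} {suc v} e = π-≡⇒≈ (suc-injective e)

      ≈⇒π′-≡ : ∀ {u v} → u ≈ v → π′ u ≡ π′ v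
      ≈⇒π′-≡ {zero}  {zero}  _ = refl
      ≈⇒π′-≡ {zero}  {suc v} e = ⊥-elim (0≉ v e)
      ≈⇒π′-≡ {suc u} {zero}  e = ⊥-elim (0≉ u (≈-sym e))
      ≈⇒π′-≡ {suc u} {suc v} e = cong suc (≈⇒π-≡ e)

quotient : ∀ {k} {_≈_ : Fin k → Fin k → Set} → IsDecEquivalence _≈_ → Quotient _≈_
quotient {ℕ.zero} _ = record
  { m = ℕ.zero ; π = λ () ; π-surjective = λ () ; π-≡⇒≈ = λ {} ; ≈⇒π-≡ = λ {} }
quotient {ℕ.suc k} {_≈_} ≈-isDecEquivalence = extend (any? (λ i → zero ≈? suc i))
  where
  open IsDecEquivalence ≈-isDecEquivalence renaming (_≟_ to _≈?_)
  Q : Quotient (λ i j → suc i ≈ suc j)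
  Q = quotient (tail-isDecEquivalence ≈-isDecEquivalence)
  extend : Dec (∃ λ i → zero ≈ suc i) → Quotient _≈_
  extend (yes (i , 0≈i)) = quotient-joining ≈-isDecEquivalence Q i 0≈i
  extend (no ¬0≈) = quotient-new-class ≈-isDecEquivalence Q (λ i 0≈i → ¬0≈ (i , 0≈i))

module βConstruction (G : Graph) (S : VSet G)
  (reach-S? : ∀ u v → Dec (PathIn G S u v))
  (reach-∁S? : ∀ u v → Dec (PathIn G (complement {G} S) u v))
  (same? : ∀ u v → Dec (SameComponent G S u v)) where

  same-refl : ∀ u → SameComponent G S u u
  same-refl u with T-or-T-not (S u)
  ... | inj₁ u∈S = inj₁ (_ , reachable-isComponent reach-S? u∈S , u↝u , u↝u)
    where u↝u = fromWitness (here u∈S)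
  ... | inj₂ u∉S = inj₂ (_ , reachable-isComponent reach-∁S? u∉S , u↝u , u↝u)
    where u↝u = fromWitness (here u∉S)

  same-isDecEquivalence : IsDecEquivalence (SameComponent G S)
  same-isDecEquivalence = record
    { isEquivalence = record { refl = same-refl _ ; sym = same-sym ; trans = same-trans }
    ; _≟_ = same?
    }

  open Quotient (quotient same-isDecEquivalence) public

  βAdjacent : Fin m → Fin m → Set
  βAdjacent x y = x ≢ y × (∃ λ u → ∃ λ v → π u ≡ x × π v ≡ y × T (adj G u v))

  βAdjacent? : ∀ x y → Dec (βAdjacent x y)
  βAdjacent? x y =
    ¬? (x ≟ y) ×-dec any? (λ u → any? (λ v → (π u ≟ x) ×-dec (π v ≟ y) ×-dec T? (adj G u v)))

  βAdjacent-sym : ∀ {x y} → βAdjacent x y → βAdjacent y x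
  βAdjacent-sym (x≢y , u , v , πu≡x , πv≡y , uv) = (x≢y ∘ sym) , v , u , πv≡y , πu≡x , adj-sym {G} uv

  β : Graph
  β = record
    { n      = m
    ; adj    = λ x y → ⌊ βAdjacent? x y ⌋
    ; sym    = λ x y → T-ext (fromWitness ∘ βAdjacent-sym ∘ toWitness)
                             (fromWitness ∘ βAdjacent-sym ∘ toWitness)
    ; irrefl = λ x → trans (isYes≗does (βAdjacent? x x))
                           (dec-false (βAdjacent? x x) (λ (x≢x , _) → x≢x refl))
    }

  β-isBeta : IsBeta G S β π
  β-isBeta = π-surjective , (λ u v → mk⇔ π-≡⇒≈ ≈⇒π-≡) , (λ x y → mk⇔ toWitness fromWitness)

β-exists : (G : Graph) (S : VSet G) → ¬ ¬ (∃ λ H → ∃ λ (π : Fin (n G) → Fin (n H)) → IsBeta G S H π)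
β-exists G S = do
  reach-S?  ← ¬¬-decidable₂ (PathIn G S)
  reach-∁S? ← ¬¬-decidable₂ (PathIn G (complement {G} S))
  same?     ← ¬¬-decidable₂ (SameComponent G S)
  let open βConstruction G S reach-S? reach-∁S? same?
  pure (β , π , β-isBeta)

module Pushforward {G H : Graph} (π : Fin (n G) → Fin (n H)) where

  fibre : Fin (n H) → VSet G
  fibre x v = ⌊ π v ≟ x ⌋

  pushforward : Weight G → Weight H
  pushforward w x = wt {G} w (fibre x)

  wt-pushforward : (w : Weight G) (A : VSet H) → wt {H} (pushforward w) A ≡ wt {G} w (A ∘ π)
  wt-pushforward w A = begin
    ∑ (λ x → if A x then ∑ (λ v → mass x v) else 0ℚ)   ≡⟨ ∑-cong (λ x → if-∑ (A x) (mass x)) ⟩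
    ∑ (λ x → ∑ (λ v → if A x then mass x v else 0ℚ))   ≡⟨ ∑-swap (λ x v → if A x then mass x v else 0ℚ) ⟩
    ∑ (λ v → ∑ (λ x → if A x then mass x v else 0ℚ))   ≡⟨ ∑-cong column ⟩
    ∑ (λ v → if A (π v) then w v else 0ℚ)              ∎
    where
    open ≡-Reasoning
    mass : Fin (n H) → Fin (n G) → ℚ
    mass x v = if fibre x v then w v else 0ℚ
    column : ∀ v → ∑ (λ x → if A x then mass x v else 0ℚ) ≡ (if A (π v) then w v else 0ℚ)
    column v = trans
      (∑-supported _ (π v) (λ x x≢πv →
        trans (cong (λ c → if A x then c else 0ℚ) (if-¬T {fibre x v} (x≢πv ∘ sym ∘ toWitness)))
              (if-eta (A x))))
      (cong (λ c → if A (π v) then c else 0ℚ) (if-T {fibre (π v) v} (fromWitness refl)))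

module β-Properties (G : Graph) (S : VSet G) (H : Graph) (π : Fin (n G) → Fin (n H))
                    (π-isBeta : IsBeta G S H π) where

  rep : Fin (n H) → Fin (n G)
  rep x = proj₁ (proj₁ π-isBeta x)

  π∘rep : ∀ x → π (rep x) ≡ x
  π∘rep x = proj₂ (proj₁ π-isBeta x)

  π-≡⇒same : ∀ {u v} → π u ≡ π v → SameComponent G S u v
  π-≡⇒same = Equivalence.to (proj₁ (proj₂ π-isBeta) _ _)

  same⇒π-≡ : ∀ {u v} → SameComponent G S u v → π u ≡ π v
  same⇒π-≡ = Equivalence.from (proj₁ (proj₂ π-isBeta) _ _)

  adj-β⇒ : ∀ {x y} → T (adj H x y) → x ≢ y × (∃ λ u → ∃ λ v → π u ≡ x × π v ≡ y × T (adj G u v))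
  adj-β⇒ = Equivalence.to (proj₂ (proj₂ π-isBeta) _ _)

  ⇒adj-β : ∀ {u v} → π u ≢ π v → T (adj G u v) → T (adj H (π u) (π v))
  ⇒adj-β πu≢πv uv = Equivalence.from (proj₂ (proj₂ π-isBeta) _ _) (πu≢πv , _ , _ , refl , refl , uv)

  Saturated : VSet G → Set
  Saturated X = ∀ {a b} → π a ≡ π b → T (X a) → T (X b)

  -- For saturated X this is the image of X under π.
  image : VSet G → VSet H
  image X x = X (rep x)

  image-preimage : {X : VSet G} → Saturated X → ∀ v → image X (π v) ≡ X v
  image-preimage X-sat v = T-ext (X-sat (π∘rep (π v))) (X-sat (sym (π∘rep (π v))))

  preimage-saturated : (Y : VSet H) → Saturated (Y ∘ π)
  preimage-saturated Y πa≡πb = subst (T ∘ Y) πa≡πb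

  fibre-path : ∀ {X u v} → π u ≡ π v → (∀ {c} → π c ≡ π u → T (X c)) → PathIn G X u v
  fibre-path πu≡πv class⊆X =
    let (K , u→v , K⊆class) = same-component-path (π-≡⇒same πu≡πv)
    in path-mono (λ _ c∈K → class⊆X (sym (same⇒π-≡ (K⊆class c∈K)))) u→v

  S-saturated : Saturated S
  S-saturated πa≡πb = subst T (same-side (π-≡⇒same πa≡πb))

  ∁S-saturated : Saturated (complement {G} S)
  ∁S-saturated πa≡πb = subst (T ∘ not) (same-side (π-≡⇒same πa≡πb))

  adjacent-same-side⇒π-≡ : ∀ {u v} → T (adj G u v) → S u ≡ S v → π u ≡ π v
  adjacent-same-side⇒π-≡ uv Su≡Sv = same⇒π-≡ (same-component-adjacent (π-≡⇒same refl) uv Su≡Sv)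

  into-image : {X : VSet G} → Saturated X → ∀ {c} → T (X c) → T (image X (π c))
  into-image X-sat {c} = X-sat (sym (π∘rep (π c)))

  component-saturated : {X C : VSet G} → Saturated X → IsComponent G X C → Saturated C
  component-saturated X-sat C-comp πa≡πb a∈C = component-path-closed C-comp a∈C
    (fibre-path πa≡πb (λ πc≡πa → X-sat (sym πc≡πa) (component-⊆ C-comp a∈C)))

  path-image : {X : VSet G} {Y : VSet H} → (∀ {c} → T (X c) → T (Y (π c))) →
               ∀ {u v} → PathIn G X u v → PathIn H Y (π u) (π v)
  path-image X⊆Y (here u∈) = here (X⊆Y u∈)
  path-image {Y = Y} X⊆Y (step {u} {w} {v} u∈ uw p) with π u ≟ π w
  ... | yes πu≡πw = subst (λ z → PathIn H Y z (π v)) (sym πu≡πw) (path-image X⊆Y p)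
  ... | no  πu≢πw = step (X⊆Y u∈) (⇒adj-β πu≢πw uw) (path-image X⊆Y p)

  module _ (Y : VSet H) where

    fibre-path-in-preimage : ∀ {x u v} → T (Y x) → π u ≡ x → π v ≡ x → PathIn G (Y ∘ π) u v
    fibre-path-in-preimage x∈ πu≡x πv≡x =
      fibre-path (trans πu≡x (sym πv≡x)) (λ πc≡πu → subst (T ∘ Y) (sym (trans πc≡πu πu≡x)) x∈)

    path-preimage : ∀ {x y} → PathIn H Y x y → ∀ {u v} → π u ≡ x → π v ≡ y → PathIn G (Y ∘ π) u v
    path-preimage (here y∈) πu≡y πv≡y = fibre-path-in-preimage y∈ πu≡y πv≡y
    path-preimage (step x∈ xx′ p) πu≡x πv≡y =
      let (_ , u₀ , v₀ , πu₀≡x , πv₀≡x′ , u₀v₀) = adj-β⇒ xx′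
          u→u₀ = fibre-path-in-preimage x∈ πu≡x πu₀≡x
      in path-++ u→u₀ (step (path-target u→u₀) u₀v₀ (path-preimage p πv₀≡x′ πv≡y))

    connected-preimage : ConnectedIn H Y → ConnectedIn G (Y ∘ π)
    connected-preimage ((x , x∈) , Y-paths) =
      (rep x , subst (T ∘ Y) (sym (π∘rep x)) x∈) ,
      λ u v u∈ v∈ → path-preimage (Y-paths _ _ u∈ v∈) refl refl

  connected-image : {X : VSet G} → Saturated X → ConnectedIn G X → ConnectedIn H (image X)
  connected-image X-sat ((v , v∈) , X-paths) =
    (π v , into-image X-sat v∈) ,
    λ x y x∈ y∈ →
      subst₂ (PathIn H _) (π∘rep x) (π∘rep y) (path-image (into-image X-sat) (X-paths _ _ x∈ y∈))

  component-image : {Y : VSet H} {D : VSet G} → IsComponent G (Y ∘ π) D → IsComponent H Y (image D)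
  component-image {Y} {D} D-comp =
    (λ x x∈ → subst (T ∘ Y) (π∘rep x) (component-⊆ D-comp x∈)) ,
    connected-image D-saturated (component-connected D-comp) ,
    λ x y x∈ y∈ xy →
      let (_ , u , v , πu≡x , πv≡y , uv) = adj-β⇒ xy
          u∈D = D-saturated (trans (π∘rep x) (sym πu≡x)) x∈
          v∈D = component-closed D-comp u∈D (subst (T ∘ Y) (sym πv≡y) y∈) uv
      in D-saturated (trans πv≡y (sym (π∘rep y))) v∈D
    where
    D-saturated : Saturated D
    D-saturated = component-saturated (preimage-saturated Y) D-comp

  open Pushforward {G} {H} π

  fibre-isComponent : {X : VSet G} → Saturated X →
                      (∀ {u v} → T (X u) → T (X v) → T (adj G u v) → π u ≡ π v) →
                      ∀ {x} → T (X (rep x)) → IsComponent G X (fibre x)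
  fibre-isComponent {X} X-sat X-adjacent {x} rep∈ =
    fibre⊆X ,
    ((rep x , fromWitness (π∘rep x)) ,
     λ a b a∈ b∈ → fibre-path (trans (toWitness a∈) (sym (toWitness b∈)))
                               (λ πc≡πa → fromWitness (trans πc≡πa (toWitness a∈)))) ,
    λ a b a∈ b∈X ab → fromWitness (trans (sym (X-adjacent (fibre⊆X a a∈) b∈X ab)) (toWitness a∈))
    where
    fibre⊆X : ∀ c → T (fibre x c) → T (X c)
    fibre⊆X c c∈ = X-sat (trans (π∘rep x) (sym (toWitness c∈))) rep∈

  S-fibre-isComponent : ∀ {x} → T (image S x) → IsComponent G S (fibre x)
  S-fibre-isComponent =
    fibre-isComponent S-saturated (λ u∈ v∈ uv → adjacent-same-side⇒π-≡ uv (T-both u∈ v∈))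

  ∁S-fibre-isComponent : ∀ {x} → T (not (image S x)) → IsComponent G (complement {G} S) (fibre x)
  ∁S-fibre-isComponent =
    fibre-isComponent ∁S-saturated (λ u∉ v∉ uv → adjacent-same-side⇒π-≡ uv (T-not-both u∉ v∉))

  adj-β-sides : ∀ {x y} → T (adj H x y) → image S x ≢ image S y
  adj-β-sides {x} {y} xy S′x≡S′y with adj-β⇒ xy
  ... | x≢y , u , v , πu≡x , πv≡y , uv = x≢y (begin
    x    ≡⟨ sym πu≡x ⟩
    π u  ≡⟨ adjacent-same-side⇒π-≡ uv Su≡Sv ⟩
    π v  ≡⟨ πv≡y ⟩
    y    ∎)
    where
    open ≡-Reasoning
    Su≡Sv : S u ≡ S v
    Su≡Sv = begin
      S u            ≡⟨ sym (image-preimage S-saturated u) ⟩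
      image S (π u)  ≡⟨ cong (image S) πu≡x ⟩
      image S x      ≡⟨ S′x≡S′y ⟩
      image S y      ≡⟨ cong (image S) (sym πv≡y) ⟩
      image S (π v)  ≡⟨ image-preimage S-saturated v ⟩
      S v            ∎

  module Weighted (w : Weight G) (w-positive : PositiveWeight G w) where

    w′ : Weight H
    w′ = pushforward w

    w≥0 : ∀ v → 0ℚ ≤ w v
    w≥0 v = ℚ.<⇒≤ (w-positive v)

    w′-positive : PositiveWeight H w′
    w′-positive x = ℚ.<-≤-trans (w-positive (rep x)) (w≤wt {G} w w≥0 {fibre x} (fromWitness (π∘rep x)))

    w′≥0 : ∀ x → 0ℚ ≤ w′ x
    w′≥0 x = ℚ.<⇒≤ (w′-positive x)

    wt-image : {X : VSet G} → Saturated X → wt {H} w′ (image X) ≡ wt {G} w X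
    wt-image {X} X-sat = trans (wt-pushforward w (image X)) (wt-cong {G} w (image-preimage X-sat))

    image-safe : IsSafe G w S → IsSafe H w′ (image S)
    image-safe ((v , v∈) , S-safe) =
      (π v , into-image S-saturated v∈) ,
      λ C′ D′ C′-comp D′-comp (x , y , x∈ , y∈ , xy) →
        let (_ , u , v , πu≡x , πv≡y , uv) = adj-β⇒ xy
            D′⊆y : ∀ z → T (D′ z) → z ≡ y
            D′⊆y z z∈ = sym (path-in-independent
              (λ a∈ b∈ ab → adj-β-sides ab (T-not-both (component-⊆ D′-comp a∈) (component-⊆ D′-comp b∈)))
              (proj₂ (component-connected D′-comp) _ _ y∈ z∈))
            w′y≤w′x : w′ y ≤ w′ x
            w′y≤w′x = S-safe (fibre x) (fibre y)
              (S-fibre-isComponent (component-⊆ C′-comp x∈)) (∁S-fibre-isComponent (component-⊆ D′-comp y∈))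
              (u , v , fromWitness πu≡x , fromWitness πv≡y , uv)
        in begin
          wt {H} w′ D′ ≤⟨ wt≤w {H} w′ w′≥0 D′⊆y ⟩
          w′ y         ≤⟨ w′y≤w′x ⟩
          w′ x         ≤⟨ w≤wt {H} w′ w′≥0 {C′} x∈ ⟩
          wt {H} w′ C′ ∎
      where open ℚ.≤-Reasoning

    preimage-connSafe : {T′ : VSet H} → IsConnSafe H w′ T′ → IsConnSafe G w (T′ ∘ π)
    preimage-connSafe {T′} ((_ , T′-safe) , T′-connected) = (proj₁ T-connected , T-safe) , T-connected
      where
      T-connected : ConnectedIn G (T′ ∘ π)
      T-connected = connected-preimage T′ T′-connected
      T-safe : ∀ C D → IsComponent G (T′ ∘ π) C → IsComponent G (complement {G} (T′ ∘ π)) D →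
               Joined G C D → wt {G} w D ≤ wt {G} w C
      T-safe C D C-comp D-comp (u , v , u∈C , v∈D , uv) = begin
        wt {G} w D            ≡⟨ sym (wt-image D-saturated) ⟩
        wt {H} w′ (image D)   ≤⟨ T′-safe T′ (image D) T′-comp (component-image D-comp) joined ⟩
        wt {H} w′ T′          ≡⟨ wt-pushforward w T′ ⟩
        wt {G} w (T′ ∘ π)     ≤⟨ wt-mono {G} w w≥0 T⊆C ⟩
        wt {G} w C            ∎
        where
        open ℚ.≤-Reasoning
        T′-comp : IsComponent H T′ T′
        T′-comp = connected-isComponent T′-connected
        T⊆C : ∀ t → T (T′ (π t)) → T (C t)
        T⊆C _ = connected-meeting-component-⊆ C-comp T-connected (λ _ t∈ → t∈) (component-⊆ C-comp u∈C) u∈C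
        D-saturated : Saturated D
        D-saturated = component-saturated (preimage-saturated (complement {H} T′)) D-comp
        joined : Joined H T′ (image D)
        joined = π u , π v , component-⊆ C-comp u∈C , into-image D-saturated v∈D ,
                 ⇒adj-β (λ πu≡πv → T-contradiction (component-⊆ C-comp u∈C)
                                     (subst (T ∘ not ∘ T′) (sym πu≡πv) (component-⊆ D-comp v∈D))) uv

    connSafe-≤-safe : ConnectedGraph G → InGcs H → IsSafe G w S →
                     ¬ ¬ (∃ λ T′ → IsConnSafe G w T′ × wt {G} w T′ ≤ wt {G} w S)
    connSafe-≤-safe G-connected H-in-Gcs S-safe = do
      (a′ , s-H)  ← minimum-exists H w′ (IsSafe H w′) ((λ _ → true) , H-safe)
      (b′ , cs-H) ← minimum-exists H w′ (IsConnSafe H w′) ((λ _ → true) , H-safe , H-connected)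
      let (T′ , T′-cs , wtT′≡b′) = proj₁ cs-H
      pure (T′ ∘ π , preimage-connSafe T′-cs , (begin
        wt {G} w (T′ ∘ π)      ≡⟨ sym (wt-pushforward w T′) ⟩
        wt {H} w′ T′           ≡⟨ wtT′≡b′ ⟩
        b′                     ≡⟨ sym (H-in-Gcs w′ w′-positive a′ b′ s-H cs-H) ⟩
        a′                     ≤⟨ proj₂ s-H (image S) (image-safe S-safe) ⟩
        wt {H} w′ (image S)    ≡⟨ wt-image S-saturated ⟩
        wt {G} w S             ∎))
      where
      open ℚ.≤-Reasoning
      H-safe : IsSafe H w′ (λ _ → true)
      H-safe = whole-safe w′ (π (proj₁ (proj₁ G-connected)))
      H-connected : ConnectedGraph H
      H-connected = connected-image (λ _ _ → tt) G-connected

s≤cs : ∀ {G w a b} → IsS G w a → IsCS G w b → a ≤ b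
s≤cs (_ , a-least) ((S , S-connSafe , wtS≡b) , _) = subst (_ ≤_) wtS≡b (a-least S (proj₁ S-connSafe))

proposition2p2 : (G : Graph) → ConnectedGraph G →
                 (∀ (S : VSet G) (H : Graph) (π : Fin (n G) → Fin (n H)) →
                    IsBeta G S H π → InGcs H) →
                 InGcs G
proposition2p2 G G-connected β-in-Gcs w w-positive a b s≡a@((S , S-safe , wtS≡a) , _) cs≡b =
  ℚ.≤-antisym (s≤cs s≡a cs≡b) (decidable-stable (b ℚ.≤? a) b≤a)
  where
  b≤a : ¬ ¬ (b ≤ a)
  b≤a = do
    (H , π , π-isBeta) ← β-exists G S
    let open β-Properties G S H π π-isBeta
        open Weighted w w-positive
    (T , T-connSafe , wtT≤wtS) ← connSafe-≤-safe G-connected (β-in-Gcs S H π π-isBeta) S-safe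
    pure (ℚ.≤-trans (proj₂ cs≡b T T-connSafe) (subst (wt {G} w T ≤_) wtS≡a wtT≤wtS))
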